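{- Let $(X,\mathcal{C})$ be an instance of 5-Double-Sat satisfying the standing assumptions in the context, and let $G=(V,E)$ be the graph constructed from it as in the context. Then for each $i$ with $1\le i\le q$, $d_G(x^T_{i,1},x^F_i)>3$.
   Context: 5-Double-Sat instance: variables $X=\{x_1,\dots,x_q\}$, clauses $\mathcal{C}=\{C_1,\dots,C_p\}$, each clause containing exactly five literals and not containing both a variable and its negation. A clause is double-satisfied by an assignment if it contains a positive literal and a negative literal both made true. Standing assumptions: each clause contains at least one positive and at least one negative literal; each variable occurs as a positive literal in some clause and as a negative literal in some clause; it is not possible to double-satisfy all clauses by setting at most two variables to true or to false. Construction of $G$: $V=\{r,r',r_T,r'_T,r^*_T,r_F,r'_F,y_1,y_2,y\}\cup\{x^T_{i,1},x^T_{i,2},x^F_i : 1\le i\le q\}\cup\{v_{C,j}:1\le j\le p\}$. Edges: $\{r,r'\},\{r',r_T\},\{r',r^*_T\},\{r',r_F\}$; for each $i$: $\{r_T,x^T_{i,1}\},\{r'_T,x^T_{i,1}\},\{x^T_{i,1},x^T_{i,2}\},\{r^*_T,x^T_{i,2}\},\{y_1,x^T_{i,2}\},\{r_F,x^F_i\},\{r'_F,x^F_i\}$; $\{x^T_{i,2},x^F_j\}$ for all $i\ne j$; $\{x^T_{i,1},v_{C,j}\}$ whenever $x_i\in C_j$; $\{x^F_i,v_{C,j}\}$ whenever $\overline{x_i}\in C_j$; $\{v_{C,j},y\}$ for all $j$; and $\{y,y_2\},\{y_1,y_2\},\{y_1,r'_T\},\{y_1,r'_F\}$. No other edges. $d_G$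 is the shortest-path distance in $G$. -}

module Defs where

open import Data.Nat using (ℕ; zero; suc; _≤_; _<_)
open import Data.Fin using (Fin)
open import Data.Bool using (Bool; true; false)
open import Data.Vec using (Vec; lookup)
open import Data.Vec.Membership.Propositional using (_∈_)
open import Data.List using (List; length; filter)
open import Data.List using () renaming (allFin to allFinL)
open import Data.Product using (Σ; _×_; _,_; ∃)
open import Data.Sum using (_⊎_)
open import Relation.Binary.PropositionalEquality using (_≡_; _≢_)
open import Relation.Nullary using (¬_)
open import Data.Bool.Properties using () renaming (_≟_ to _≟B_)

-- A literal over variables x_0 .. x_{q-1} (0-indexed: Fin q).
data Literal (q : ℕ) : Set where
  pos : Fin q → Literal q
  neg : Fin q → Literal q

Clause : ℕ → Set
Clause q = Vec (Literal q) 5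

-- the five literals are pairwise distinct (a clause is a set of exactly 5 literals)
FiveDistinct : ∀ {q} → Clause q → Set
FiveDistinct c = ∀ a b → lookup c a ≡ lookup c b → a ≡ b

NoComplementary : ∀ {q} → Clause q → Set
NoComplementary c = ∀ i → ¬ (pos i ∈ c × neg i ∈ c)

WellFormed : ∀ {q p} → (Fin p → Clause q) → Set
WellFormed {q} {p} C = ∀ j → FiveDistinct (C j) × NoComplementary (C j)

Assignment : ℕ → Set
Assignment q = Fin q → Bool

DoubleSat : ∀ {q} → Assignment q → Clause q → Set
DoubleSat a c = (∃ λ i → pos i ∈ c × a i ≡ true) × (∃ λ k → neg k ∈ c × a k ≡ false)

AllDoubleSat : ∀ {q p} → (Fin p → Clause q) → Assignment q → Set
AllDoubleSat C a = ∀ j → DoubleSat a (C j)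

numTrue : ∀ {q} → Assignment q → ℕ
numTrue {q} a = length (filter (λ i → a i ≟B true) (allFinL q))

numFalse : ∀ {q} → Assignment q → ℕ
numFalse {q} a = length (filter (λ i → a i ≟B false) (allFinL q))

StandingAssumptions : ∀ {q p} → (Fin p → Clause q) → Set
StandingAssumptions {q} {p} C =
  (∀ j → (∃ λ i → pos i ∈ C j) × (∃ λ i → neg i ∈ C j))
  × (∀ i → (∃ λ j → pos i ∈ C j) × (∃ λ j → neg i ∈ C j))
  × (∀ (a : Assignment q) → (numTrue a ≤ 2 ⊎ numFalse a ≤ 2) → ¬ AllDoubleSat C a)

data V (q p : ℕ) : Set where
  r r' rT r'T r*T rF r'F y₁ y₂ y : V q p
  xT1 xT2 xF : Fin q → V q p
  vC : Fin p → V q p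

-- the listed edges (each given in one orientation)
data Edge {q p : ℕ} (C : Fin p → Clause q) : V q p → V q p → Set where
  e-r-r'     : Edge C r r'
  e-r'-rT    : Edge C r' rT
  e-r'-r*T   : Edge C r' r*T
  e-r'-rF    : Edge C r' rF
  e-rT-xT1   : ∀ i → Edge C rT (xT1 i)
  e-r'T-xT1  : ∀ i → Edge C r'T (xT1 i)
  e-xT1-xT2  : ∀ i → Edge C (xT1 i) (xT2 i)
  e-r*T-xT2  : ∀ i → Edge C r*T (xT2 i)
  e-y₁-xT2   : ∀ i → Edge C y₁ (xT2 i)
  e-rF-xF    : ∀ i → Edge C rF (xF i)
  e-r'F-xF   : ∀ i → Edge C r'F (xF i)
  e-xT2-xF   : ∀ i j → i ≢ j → Edge C (xT2 i) (xF j)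
  e-xT1-vC   : ∀ i j → pos i ∈ C j → Edge C (xT1 i) (vC j)
  e-xF-vC    : ∀ i j → neg i ∈ C j → Edge C (xF i) (vC j)
  e-vC-y     : ∀ j → Edge C (vC j) y
  e-y-y₂     : Edge C y y₂
  e-y₁-y₂    : Edge C y₁ y₂
  e-y₁-r'T   : Edge C y₁ r'T
  e-y₁-r'F   : Edge C y₁ r'F

Adj : ∀ {q p} (C : Fin p → Clause q) → V q p → V q p → Set
Adj C u v = Edge C u v ⊎ Edge C v u

data Walk {q p : ℕ} (C : Fin p → Clause q) : V q p → V q p → ℕ → Set where
  []  : ∀ {u} → Walk C u u 0
  _∷_ : ∀ {u v w n} → Adj C u v → Walk C v w n → Walk C u w (suc n)

-- d_G(u,v) > k : there is no walk (equivalently no path) of length ≤ k,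
-- i.e. the shortest-path distance (∞ if disconnected) exceeds k.
DistGreater : ∀ {q p} (C : Fin p → Clause q) → V q p → V q p → ℕ → Set
DistGreater C u v k = ∀ n → n ≤ k → ¬ Walk C u v n

module Submission where

-- A walk of length at most 3 from u to v is u = v, an edge u–v,
-- a common neighbour of u and v, or an edge between a neighbour of u and a
-- neighbour of v.  So d_G(u,v) > 3 follows once these four configurations
-- are excluded (lemma distGreater3).  For u = x^T_{i,1} and v = x^F_i we
-- describe both neighbourhoods explicitly:
--   N(x^T_{i,1}) = {r_T, r'_T, x^T_{i,2}} ∪ {v_{C,j} : x_i ∈ C_j},
--   N(x^F_i)     = {r_F, r'_F} ∪ {x^T_{k,2} : k ≠ i} ∪ {v_{C,j} : ¬x_i ∈ C_j}.
-- They are disjoint: x^T_{i,2} is not adjacent to x^F_i, and a common clause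
-- vertex would contain both x_i and its negation, which well-formedness
-- forbids.  No vertex of the first set is adjacent to one of the second,
-- which is read off the edge list.

open import Defs
open import Data.Nat using (ℕ; z≤n; s≤s)
open import Data.Fin using (Fin)
open import Data.Sum using (inj₁; inj₂)
open import Data.Product using (_,_; proj₂)
open import Relation.Binary.PropositionalEquality using (_≢_; refl)
open import Relation.Nullary using (¬_)
open import Data.Vec.Membership.Propositional using (_∈_)

module _ {q p : ℕ} (C : Fin p → Clause q) where

  distGreater3 : ∀ {u v} → u ≢ v → ¬ Adj C u v →
                 (∀ {a} → Adj C u a → ¬ Adj C a v) →
                 (∀ {a b} → Adj C u a → Adj C b v → ¬ Adj C a b) →
                 DistGreater C u v 3
  distGreater3 u≢v _ _ _ _ z≤n [] = u≢v refl
  distGreater3 _ notAdj _ _ _ (s≤s z≤n) (e ∷ []) = notAdj e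
  distGreater3 _ _ noCommon _ _ (s≤s (s≤s z≤n)) (e ∷ (f ∷ [])) = noCommon e f
  distGreater3 _ _ _ noBridge _ (s≤s (s≤s (s≤s z≤n))) (e ∷ (f ∷ (g ∷ []))) =
    noBridge e g f

  data NbrT1 (i : Fin q) : V q p → Set where
    n-rT  : NbrT1 i rT
    n-r'T : NbrT1 i r'T
    n-xT2 : NbrT1 i (xT2 i)
    n-vC  : ∀ j → pos i ∈ C j → NbrT1 i (vC j)

  data NbrF (i : Fin q) : V q p → Set where
    n-rF  : NbrF i rF
    n-r'F : NbrF i r'F
    n-xT2 : ∀ k → k ≢ i → NbrF i (xT2 k)
    n-vC  : ∀ j → neg i ∈ C j → NbrF i (vC j)

  nbrT1 : ∀ {i a} → Adj C (xT1 i) a → NbrT1 i a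
  nbrT1 (inj₁ (e-xT1-xT2 _))     = n-xT2
  nbrT1 (inj₁ (e-xT1-vC _ j i∈)) = n-vC j i∈
  nbrT1 (inj₂ (e-rT-xT1 _))      = n-rT
  nbrT1 (inj₂ (e-r'T-xT1 _))     = n-r'T

  nbrF : ∀ {i b} → Adj C b (xF i) → NbrF i b
  nbrF (inj₁ (e-rF-xF _))          = n-rF
  nbrF (inj₁ (e-r'F-xF _))         = n-r'F
  nbrF (inj₁ (e-xT2-xF k _ k≢i))   = n-xT2 k k≢i
  nbrF (inj₂ (e-xF-vC _ j ¬i∈))    = n-vC j ¬i∈

  xF-notNbrT1 : ∀ {i} → ¬ NbrT1 i (xF i)
  xF-notNbrT1 ()

  -- The two neighbourhoods are disjoint; for clause vertices this is exactly
  -- the absence of complementary literals in a clause.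
  nbrs-disjoint : WellFormed C → ∀ {i a} → NbrT1 i a → ¬ NbrF i a
  nbrs-disjoint _  n-xT2         (n-xT2 _ i≢i)   = i≢i refl
  nbrs-disjoint wf (n-vC j i∈)   (n-vC .j ¬i∈)   = proj₂ (wf j) _ (i∈ , ¬i∈)

  nbrs-nonadjacent : ∀ {i a b} → NbrT1 i a → NbrF i b → ¬ Adj C a b
  nbrs-nonadjacent n-rT      () (inj₁ (e-rT-xT1 _))
  nbrs-nonadjacent n-rT      () (inj₂ e-r'-rT)
  nbrs-nonadjacent n-r'T     () (inj₁ (e-r'T-xT1 _))
  nbrs-nonadjacent n-r'T     () (inj₂ e-y₁-r'T)
  nbrs-nonadjacent n-xT2     () (inj₁ (e-xT2-xF _ _ _))
  nbrs-nonadjacent n-xT2     () (inj₂ (e-xT1-xT2 _))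
  nbrs-nonadjacent n-xT2     () (inj₂ (e-r*T-xT2 _))
  nbrs-nonadjacent n-xT2     () (inj₂ (e-y₁-xT2 _))
  nbrs-nonadjacent (n-vC _ _) () (inj₁ (e-vC-y _))
  nbrs-nonadjacent (n-vC _ _) () (inj₂ (e-xT1-vC _ _ _))
  nbrs-nonadjacent (n-vC _ _) () (inj₂ (e-xF-vC _ _ _))

lemma5 : (q p : ℕ) (C : Fin p → Clause q) →
         WellFormed C → StandingAssumptions C →
         (i : Fin q) → DistGreater C (xT1 i) (xF i) 3
lemma5 q p C wf _ i =
  distGreater3 C (λ ())
    (λ e → xF-notNbrT1 C (nbrT1 C e))
    (λ e f → nbrs-disjoint C wf (nbrT1 C e) (nbrF C f))
    (λ e g → nbrs-nonadjacent C (nbrT1 C e) (nbrF C g))
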